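{- Let $H=(\mathcal{V},\mathcal{I})$ be a proper interval hypergraph. Then $H$ is exactly hittable.
   Context: An interval hypergraph is $H=(\mathcal{V},\mathcal{I})$ with $\mathcal{V}=[n]$ and $\mathcal{I}$ a set of intervals $\{i,\dots,j\}\subseteq[n]$. It is proper if no interval of $\mathcal{I}$ is contained in another (distinct) interval of $\mathcal{I}$. $H$ is exactly hittable if there exists $S\subseteq\mathcal{V}$ with $|S\cap I|=1$ for every $I\in\mathcal{I}$. -}

module Defs where

open import Data.Nat using (ℕ; zero; suc; _+_; _∸_; _≤_)
open import Data.Bool using (Bool; true; false)
open import Data.List using (List; []; _∷_; length; filter; map)
open import Data.List.Membership.Propositional using (_∈_)
open import Data.Product using (_×_; Σ; _,_; proj₁; proj₂)
open import Relation.Binary.PropositionalEquality using (_≡_)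
open import Relation.Nullary using (¬_)
open import Data.Bool using (T)

-- Vertex set is [n] = {1,…,n} ⊆ ℕ.
-- An interval {i,…,j} is represented by its endpoints (i , j).
Interval : Set
Interval = ℕ × ℕ

IsIntervalOf : ℕ → Interval → Set
IsIntervalOf n (i , j) = (1 ≤ i) × (i ≤ j) × (j ≤ n)

record IntervalHypergraph : Set where
  field
    n         : ℕ
    intervals : List Interval
    wf        : ∀ I → I ∈ intervals → IsIntervalOf n I
open IntervalHypergraph public

_∈ᵢ_ : ℕ → Interval → Set
x ∈ᵢ (i , j) = (i ≤ x) × (x ≤ j)

_⊆ᵢ_ : Interval → Interval → Set
I ⊆ᵢ J = ∀ x → x ∈ᵢ I → x ∈ᵢ J

Proper : IntervalHypergraph → Set
Proper H = ∀ I J → I ∈ intervals H → J ∈ intervals H → ¬ (I ≡ J) → ¬ (I ⊆ᵢ J)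

range : ℕ → ℕ → List ℕ
range i zero    = []
range i (suc k) = i ∷ range (suc i) k

vertices : Interval → List ℕ
vertices (i , j) = range i (suc j ∸ i)

card∩ : (ℕ → Bool) → Interval → ℕ
card∩ S I = length (filter (λ x → Data.Bool.T? (S x)) (vertices I))

ExactlyHittable : IntervalHypergraph → Set
ExactlyHittable H =
  Σ (ℕ → Bool) λ S →
    (∀ x → T (S x) → (1 ≤ x) × (x ≤ n H)) ×
    (∀ I → I ∈ intervals H → card∩ S I ≡ 1)

-- The hitting set is built greedily from left to right: a vertex y is chosen
-- exactly when some interval ends at y and contains no vertex chosen so far,
-- i.e. it starts after the last chosen vertex before y.  Then
--   * every interval is hit: either it already contains the last chosen vertex
--     before its right end, or it triggers the choice of its right end;
--   * no interval (a , b) is hit twice: if x < y were both chosen in it, the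
--     interval (a' , y) that triggered y starts after x ≥ a, so it is strictly
--     contained in (a , b) — impossible in a proper hypergraph.
module Submission where

open import Defs
open import Data.Nat using (ℕ; zero; suc; _+_; _∸_; _≤_; _<_; _≡ᵇ_; _<ᵇ_; s≤s; z≤n; z<s)
open import Data.Nat.Properties
open import Data.Bool using (Bool; true; false; T; T?; _∧_; if_then_else_)
open import Data.Bool.Properties using (T-∧)
open import Data.Unit using (tt)
open import Data.Empty using (⊥; ⊥-elim)
open import Data.List using (List; _∷_; length; filter)
open import Data.Bool.ListAction using (any)
open import Data.List.Properties using (filter-accept; filter-reject; filter-none)
open import Data.List.Membership.Propositional using (_∈_; find; lose)
open import Data.List.Relation.Unary.Any using (here; there)
open import Data.List.Relation.Unary.Any.Properties using (any⁺; any⁻)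
open import Data.List.Relation.Unary.All as All using (All)
open import Data.List.Relation.Unary.Unique.Propositional using (Unique; []; _∷_)
open import Data.Product using (_×_; ∃; _,_; proj₁)
open import Data.Sum using (inj₁; inj₂)
open import Function.Bundles using (Equivalence)
open import Relation.Binary.PropositionalEquality
open import Relation.Binary using (tri<; tri≈; tri>)
open import Relation.Nullary using (¬_; yes; no)
open import Relation.Unary using (Decidable)

filter-single : ∀ {A : Set} {P : A → Set} (P? : Decidable P) {xs : List A} {x : A} →
                Unique xs → x ∈ xs → P x → (∀ y → y ∈ xs → P y → y ≡ x) →
                length (filter P? xs) ≡ 1
filter-single {P = P} P? {z ∷ zs} (z∉zs ∷ _) (here refl) pz only =
  cong length (trans (filter-accept P? pz) (cong (z ∷_) (filter-none P? none)))
  where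
  -- any other satisfying element would equal z, but z does not occur in zs
  none : All (λ w → ¬ P w) zs
  none = All.tabulate λ w∈zs pw → All.lookup z∉zs w∈zs (sym (only _ (there w∈zs) pw))
filter-single {P = P} P? {z ∷ zs} (z∉zs ∷ uniq) (there x∈zs) px only =
  trans (cong length (filter-reject P? ¬pz))
        (filter-single P? uniq x∈zs px (λ y y∈zs → only y (there y∈zs)))
  where
  -- z satisfying P would make z = x, an element of zs
  ¬pz : ¬ P z
  ¬pz pz = All.lookup z∉zs x∈zs (only z (here refl) pz)

∈-range⁻ : ∀ {i k y} → y ∈ range i k → i ≤ y × y < i + k
∈-range⁻ {i} {suc k} (here refl) = ≤-refl , m<m+n i z<s
∈-range⁻ {i} {suc k} {y} (there y∈) with ∈-range⁻ y∈
... | i<y , y<i+1+k = ≤-trans (n≤1+n i) i<y , subst (y <_) (sym (+-suc i k)) y<i+1+k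

∈-range⁺ : ∀ {i k y} → i ≤ y → y < i + k → y ∈ range i k
∈-range⁺ {i} {zero} i≤y y<i+0 =
  ⊥-elim (<-irrefl refl (≤-<-trans i≤y (subst (_ <_) (+-identityʳ i) y<i+0)))
∈-range⁺ {i} {suc k} {y} i≤y y<i+k with m≤n⇒m<n∨m≡n i≤y
... | inj₂ refl = here refl
... | inj₁ i<y = there (∈-range⁺ i<y (subst (y <_) (+-suc i k) y<i+k))

range-unique : ∀ i k → Unique (range i k)
range-unique i zero = []
range-unique i (suc k) =
  All.tabulate (λ y∈ → <⇒≢ (proj₁ (∈-range⁻ y∈))) ∷ range-unique (suc i) k

∈-vertices⁻ : ∀ {a b y} → a ≤ b → y ∈ vertices (a , b) → y ∈ᵢ (a , b)
∈-vertices⁻ {a} {b} {y} a≤b y∈ with ∈-range⁻ y∈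
... | a≤y , y<end = a≤y , ≤-pred (subst (y <_) (m+[n∸m]≡n (m≤n⇒m≤1+n a≤b)) y<end)

∈-vertices⁺ : ∀ {a b y} → a ≤ b → y ∈ᵢ (a , b) → y ∈ vertices (a , b)
∈-vertices⁺ {a} {b} {y} a≤b (a≤y , y≤b) =
  ∈-range⁺ a≤y (subst (y <_) (sym (m+[n∸m]≡n (m≤n⇒m≤1+n a≤b))) (s≤s y≤b))

card∩-one : ∀ (S : ℕ → Bool) {a b} x → a ≤ b → x ∈ᵢ (a , b) → T (S x) →
            (∀ y → y ∈ᵢ (a , b) → T (S y) → y ≡ x) → card∩ S (a , b) ≡ 1
card∩-one S {a} {b} x a≤b x∈I sx only =
  filter-single (λ v → T? (S v)) (range-unique a (suc b ∸ a))
    (∈-vertices⁺ a≤b x∈I) sx (λ y y∈ → only y (∈-vertices⁻ a≤b y∈))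

module Greedy (Is : List Interval) where

  endsAtAfter : ℕ → ℕ → Interval → Bool
  endsAtAfter y L (a , b) = (b ≡ᵇ y) ∧ (L <ᵇ a)

  -- chosen y: some interval ends at y and misses every vertex chosen before y;
  -- lastChosen x: the largest chosen vertex ≤ x (0 if there is none)
  chosen : ℕ → Bool
  lastChosen : ℕ → ℕ

  chosen zero = false
  chosen (suc y) = any (endsAtAfter (suc y) (lastChosen y)) Is

  lastChosen zero = zero
  lastChosen (suc x) = if chosen (suc x) then suc x else lastChosen x

  chosen-trigger : ∀ y → T (chosen (suc y)) →
                   ∃ λ a → (a , suc y) ∈ Is × lastChosen y < a
  chosen-trigger y ch with find (any⁻ _ Is ch)
  ... | (a , b) , I∈ , hit with Equivalence.to T-∧ hit
  ...   | b≡y , L<a =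
    a , subst (λ c → (a , c) ∈ Is) (≡ᵇ⇒≡ b (suc y) b≡y) I∈ , <ᵇ⇒< _ a L<a

  trigger-chosen : ∀ a y → (a , suc y) ∈ Is → lastChosen y < a → T (chosen (suc y))
  trigger-chosen a y I∈ L<a =
    any⁺ _ (lose I∈ (Equivalence.from T-∧ (≡⇒≡ᵇ (suc y) (suc y) refl , <⇒<ᵇ L<a)))

  lastChosen-≤ : ∀ x → lastChosen x ≤ x
  lastChosen-≤ zero = z≤n
  lastChosen-≤ (suc x) with chosen (suc x)
  ... | true = ≤-refl
  ... | false = m≤n⇒m≤1+n (lastChosen-≤ x)

  chosen-≤-lastChosen : ∀ x y → T (chosen y) → y ≤ x → y ≤ lastChosen x
  chosen-≤-lastChosen x zero () _
  chosen-≤-lastChosen (suc x) (suc y) ch y≤x with chosen (suc x) in eq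
  ... | true = y≤x
  ... | false with m≤n⇒m<n∨m≡n y≤x
  ...   | inj₁ (s≤s y<x) = chosen-≤-lastChosen x (suc y) ch y<x
  ...   | inj₂ refl rewrite eq = ⊥-elim ch

  lastChosen-chosen : ∀ x → 1 ≤ lastChosen x → T (chosen (lastChosen x))
  lastChosen-chosen (suc x) pos with chosen (suc x) in eq
  ... | true rewrite eq = tt
  ... | false = lastChosen-chosen x pos

  hits : ∀ a b → (a , b) ∈ Is → 1 ≤ a → a ≤ b → ∃ λ x → x ∈ᵢ (a , b) × T (chosen x)
  hits zero zero _ () _
  hits a (suc b) I∈ 1≤a a≤b with a ≤? lastChosen b
  ... | yes a≤L = lastChosen b , (a≤L , m≤n⇒m≤1+n (lastChosen-≤ b))
                , lastChosen-chosen b (≤-trans 1≤a a≤L)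
  ... | no a≰L = suc b , (a≤b , ≤-refl) , trigger-chosen a b I∈ (≰⇒> a≰L)

module GreedyOnProper (H : IntervalHypergraph) (proper : Proper H) where
  open Greedy (intervals H)

  -- two chosen vertices x < y inside an interval J of H would make the interval
  -- triggering y a proper subinterval of J
  no-two-chosen : ∀ {a b x y} → (a , b) ∈ intervals H → a ≤ x → y ≤ b → x < y →
                  T (chosen x) → T (chosen y) → ⊥
  no-two-chosen {a} {b} {x} {suc y} J∈ a≤x y≤b (s≤s x≤y) chx chy
    with chosen-trigger y chy
  ... | a' , I∈ , L<a' = proper (a' , suc y) (a , b) I∈ J∈ distinct contained
    where
    a<a' : a < a'
    a<a' = ≤-<-trans a≤x (≤-<-trans (chosen-≤-lastChosen y x chx x≤y) L<a')

    distinct : ¬ ((a' , suc y) ≡ (a , b))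
    distinct eq = <-irrefl (sym (cong proj₁ eq)) a<a'

    contained : (a' , suc y) ⊆ᵢ (a , b)
    contained z (a'≤z , z≤y) = ≤-trans (<⇒≤ a<a') a'≤z , ≤-trans z≤y y≤b

  at-most-one : ∀ {a b x y} → (a , b) ∈ intervals H → x ∈ᵢ (a , b) → y ∈ᵢ (a , b) →
                T (chosen x) → T (chosen y) → y ≡ x
  at-most-one {x = x} {y} J∈ (a≤x , x≤b) (a≤y , y≤b) chx chy with <-cmp x y
  ... | tri< x<y _ _ = ⊥-elim (no-two-chosen J∈ a≤x y≤b x<y chx chy)
  ... | tri≈ _ x≡y _ = sym x≡y
  ... | tri> _ _ y<x = ⊥-elim (no-two-chosen J∈ a≤y x≤b y<x chy chx)

  -- chosen vertices are right endpoints of intervals, hence lie in [n]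
  chosen-in-range : ∀ x → T (chosen x) → (1 ≤ x) × (x ≤ n H)
  chosen-in-range (suc y) ch with chosen-trigger y ch
  ... | a , I∈ , _ with wf H _ I∈
  ...   | _ , _ , y≤n = s≤s z≤n , y≤n

lemma9 : (H : IntervalHypergraph) → Proper H → ExactlyHittable H
lemma9 H proper = chosen , chosen-in-range , exactly-one
  where
  open Greedy (intervals H)
  open GreedyOnProper H proper

  exactly-one : ∀ I → I ∈ intervals H → card∩ chosen I ≡ 1
  exactly-one (a , b) I∈ with wf H _ I∈
  ... | 1≤a , a≤b , _ with hits a b I∈ 1≤a a≤b
  ...   | x , x∈I , chx =
    card∩-one chosen x a≤b x∈I chx (λ y y∈I chy → at-most-one I∈ x∈I y∈I chx chy)
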